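{- Let $(A,\rightarrow,\rightsquigarrow,1)$ be a distributive pseudo-BE(A) algebra, let $s$ be a Bosbach state on $A$, and let $K=\mathrm{Ker}(s)=\{x\in A\mid s(x)=1\}$. Consider the quotient $A/K$ by the congruence $\Theta_K$. Then the operations induced on $A/K$ by $\rightarrow$ and by $\rightsquigarrow$ coincide, i.e. $(A/K,\rightarrow,1/K)=(A/K,\rightsquigarrow,1/K)$ (equivalently $(x\rightarrow y)/K=(x\rightsquigarrow y)/K$ for all $x,y\in A$), and $x/K\vee y/K=y/K\vee x/K$ for all $x,y\in A$, where $u\vee v=(u\rightarrow v)\rightarrow v$ in $A/K$.
   Context: A pseudo-BE algebra is an algebra $(A,\rightarrow,\rightsquigarrow,1)$ of type $(2,2,0)$ such that for all $x,y,z\in A$: $x\rightarrow x=x\rightsquigarrow x=1$; $x\rightarrow 1=x\rightsquigarrow 1=1$; $1\rightarrow x=1\rightsquigarrow x=x$; $x\rightarrow(y\rightsquigarrow z)=y\rightsquigarrow(x\rightarrow z)$; $x\rightarrow y=1$ iff $x\rightsquigarrow y=1$. Write $x\le y$ iff $x\rightarrow y=1$. It is a pseudo-BE(A) algebra if $x\le y$ implies $y\rightarrow z\le x\rightarrow z$ and $y\rightsquigarrow z\le x\rightsquigarrow z$ for all $z$. It is distributive if $x\rightarrow(y\rightsquigarrow z)=(x\rightarrow y)\rightsquigarrow(x\rightarrow z)$ for all $x,y,z$. A Bosbach state is a map $s:A\to[0,1]$ with $s(1)=1$, $s(x)+s(x\rightarrow y)=s(y)+s(y\rightarrow x)$ and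 $s(x)+s(x\rightsquigarrow y)=s(y)+s(y\rightsquigarrow x)$ for all $x,y$. A deductive system of $A$ is a set $D\subseteq A$ with $1\in D$ such that $x\in D$ and $x\rightarrow y\in D$ imply $y\in D$; $\mathrm{Ker}(s)$ is a deductive system. For a deductive system $H$ of a distributive pseudo-BE algebra, $\Theta_H$ is the congruence given by $(x,y)\in\Theta_H$ iff $x\rightarrow y\in H$ and $y\rightarrow x\in H$; $A/H$ is the quotient with classes $x/H$ and operations $x/H\rightarrow y/H=(x\rightarrow y)/H$, $x/H\rightsquigarrow y/H=(x\rightsquigarrow y)/H$, top $1/H$. -}

module Defs where

open import Level using (0ℓ)
open import Data.Product using (Σ; _×_; _,_)
open import Data.Sum using (_⊎_)
open import Relation.Nullary using (¬_)
open import Relation.Binary.PropositionalEquality using (_≡_)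
open import Algebra.Structures using (IsCommutativeRing)

-- The real numbers (agda-stdlib has none): axiomatised as a complete
-- ordered field.  Classically any two such structures are isomorphic,
-- so quantifying over all of them is quantifying over ℝ.

record RealNumbers : Set₁ where
  infixl 6 _+_
  infixl 7 _*_
  infix  4 _≤_
  field
    ℝ       : Set
    _+_ _*_ : ℝ → ℝ → ℝ
    -_      : ℝ → ℝ
    0ℝ 1ℝ   : ℝ
    _≤_     : ℝ → ℝ → Set
    isCommutativeRing : IsCommutativeRing _≡_ _+_ _*_ -_ 0ℝ 1ℝ
    0≢1     : ¬ (0ℝ ≡ 1ℝ)
    inverse : ∀ x → ¬ (x ≡ 0ℝ) → Σ ℝ λ y → x * y ≡ 1ℝ
    ≤-refl  : ∀ x → x ≤ x
    ≤-trans : ∀ {x y z} → x ≤ y → y ≤ z → x ≤ z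
    ≤-antisym : ∀ {x y} → x ≤ y → y ≤ x → x ≡ y
    ≤-total : ∀ x y → (x ≤ y) ⊎ (y ≤ x)
    +-mono-≤ : ∀ {x y} z → x ≤ y → x + z ≤ y + z
    *-nonneg : ∀ {x y} → 0ℝ ≤ x → 0ℝ ≤ y → 0ℝ ≤ x * y
    sup : (P : ℝ → Set) → Σ ℝ P → Σ ℝ (λ b → ∀ x → P x → x ≤ b) →
          Σ ℝ λ m → (∀ x → P x → x ≤ m) × (∀ b → (∀ x → P x → x ≤ b) → m ≤ b)

record PseudoBE : Set₁ where
  infixr 5 _⇒_ _⇝_
  infix 4 _≼_
  field
    A   : Set
    _⇒_ : A → A → A
    _⇝_ : A → A → A
    𝟏   : A
    refl⇒ : ∀ x → x ⇒ x ≡ 𝟏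
    refl⇝ : ∀ x → x ⇝ x ≡ 𝟏
    top⇒  : ∀ x → x ⇒ 𝟏 ≡ 𝟏
    top⇝  : ∀ x → x ⇝ 𝟏 ≡ 𝟏
    left⇒ : ∀ x → 𝟏 ⇒ x ≡ x
    left⇝ : ∀ x → 𝟏 ⇝ x ≡ x
    exch  : ∀ x y z → x ⇒ (y ⇝ z) ≡ y ⇝ (x ⇒ z)
    ⇒to⇝  : ∀ x y → x ⇒ y ≡ 𝟏 → x ⇝ y ≡ 𝟏
    ⇝to⇒  : ∀ x y → x ⇝ y ≡ 𝟏 → x ⇒ y ≡ 𝟏

  _≼_ : A → A → Set
  x ≼ y = x ⇒ y ≡ 𝟏

IsPseudoBEA : PseudoBE → Set
IsPseudoBEA B = ∀ x y z → x ≼ y → (y ⇒ z ≼ x ⇒ z) × (y ⇝ z ≼ x ⇝ z)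
  where open PseudoBE B

IsDistributive : PseudoBE → Set
IsDistributive B = ∀ x y z → x ⇒ (y ⇝ z) ≡ (x ⇒ y) ⇝ (x ⇒ z)
  where open PseudoBE B

record BosbachState (R : RealNumbers) (B : PseudoBE) : Set where
  open RealNumbers R
  open PseudoBE B
  field
    s      : A → ℝ
    s-low  : ∀ x → 0ℝ ≤ s x
    s-high : ∀ x → s x ≤ 1ℝ
    s-one  : s 𝟏 ≡ 1ℝ
    bos⇒   : ∀ x y → s x + s (x ⇒ y) ≡ s y + s (y ⇒ x)
    bos⇝   : ∀ x y → s x + s (x ⇝ y) ≡ s y + s (y ⇝ x)

Ker : {R : RealNumbers} {B : PseudoBE} → BosbachState R B → PseudoBE.A B → Set
Ker {R} st x = BosbachState.s st x ≡ RealNumbers.1ℝ R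

-- The congruence Θ_H of a subset H: (x,y) ∈ Θ_H iff x→y ∈ H and y→x ∈ H.
-- x/H = y/H in A/H holds exactly when Θ H x y.
Θ : (B : PseudoBE) → (PseudoBE.A B → Set) → PseudoBE.A B → PseudoBE.A B → Set
Θ B H x y = H (x ⇒ y) × H (y ⇒ x)
  where open PseudoBE B

module Submission where

-- Everything is reduced to one principle about states: if p ≼ q and
-- s p = s q then (q, p) ∈ Θ_K, because a Bosbach state satisfies
-- s q + s (q ⇒ p) = s p + 1 whenever p ≼ q.
-- The first half of the theorem follows from a cycle of inequalities
-- s (x ⇒ y) ≤ s (c ⇒ y) = s (c ⇝ y) ≤ s (x ⇝ y) ≤ s (x ⇒ y) with
-- c = (x ⇒ y) ⇝ y.  For the second half we compute the state of the
-- ⇝-join u' = (x ⇒ y) ⇝ y: s u' + s (y ⇒ x) = s x + 1, which is symmetric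
-- in x and y; from it u' ⇒ (y ⇒ x) ⇝ x lies in K.  Finally each ⇝-join lies
-- below the corresponding ⇒-join with the same state, which transfers this
-- to the ⇒-joins using upward closure of K.

open import Defs
open import Data.Product using (_×_; _,_; proj₁; proj₂)
open import Relation.Binary.PropositionalEquality
open import Algebra.Bundles using (CommutativeRing)
import Algebra.Properties.Group as GroupProperties
import Algebra.Properties.CommutativeSemigroup as CommSemigroupProperties

module PseudoBEOrder (B : PseudoBE) where
  open PseudoBE B

  ≼-⇝ : ∀ x y → y ≼ x ⇝ y
  ≼-⇝ x y = begin
      y ⇒ (x ⇝ y)  ≡⟨ exch y x y ⟩
      x ⇝ (y ⇒ y)  ≡⟨ cong (x ⇝_) (refl⇒ y) ⟩
      x ⇝ 𝟏        ≡⟨ top⇝ x ⟩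
      𝟏            ∎
    where open ≡-Reasoning

  ≼-⇒ : ∀ x y → y ≼ x ⇒ y
  ≼-⇒ x y = ⇝to⇒ y (x ⇒ y) (begin
      y ⇝ (x ⇒ y)  ≡⟨ sym (exch x y y) ⟩
      x ⇒ (y ⇝ y)  ≡⟨ cong (x ⇒_) (refl⇝ y) ⟩
      x ⇒ 𝟏        ≡⟨ top⇒ x ⟩
      𝟏            ∎)
    where open ≡-Reasoning

  ≼-join⇝ : ∀ x y → x ≼ (x ⇒ y) ⇝ y
  ≼-join⇝ x y = trans (exch x (x ⇒ y) y) (refl⇝ (x ⇒ y))

  ≼-join⇒ : ∀ p q → p ≼ (p ⇝ q) ⇒ q
  ≼-join⇒ p q = ⇝to⇒ p ((p ⇝ q) ⇒ q)
    (trans (sym (exch (p ⇝ q) p q)) (refl⇒ (p ⇝ q)))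

module DistributiveOrder (B : PseudoBE) (dist : IsDistributive B) where
  open PseudoBE B
  open PseudoBEOrder B

  ⇒-isotone : ∀ {p q} r → p ≼ q → r ⇒ p ≼ r ⇒ q
  ⇒-isotone {p} {q} r p≼q = ⇝to⇒ (r ⇒ p) (r ⇒ q) (begin
      (r ⇒ p) ⇝ (r ⇒ q)  ≡⟨ sym (dist r p q) ⟩
      r ⇒ (p ⇝ q)        ≡⟨ cong (r ⇒_) (⇒to⇝ p q p≼q) ⟩
      r ⇒ 𝟏              ≡⟨ top⇒ r ⟩
      𝟏                  ∎)
    where open ≡-Reasoning

  ⇝-≼-⇒ : ∀ x y → x ⇝ y ≼ x ⇒ y
  ⇝-≼-⇒ x y = subst (x ⇝ y ≼_) absorb (≼-⇒ x (x ⇝ y))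
    where
    absorb : x ⇒ (x ⇝ y) ≡ x ⇒ y
    absorb = trans (dist x x y) (trans (cong (_⇝ (x ⇒ y)) (refl⇒ x)) (left⇝ (x ⇒ y)))

module BosbachFacts (R : RealNumbers) (B : PseudoBE) (st : BosbachState R B) where
  open RealNumbers R
  open PseudoBE B
  open BosbachState st

  ℝ-ring : CommutativeRing _ _
  ℝ-ring = record { isCommutativeRing = isCommutativeRing }
  open CommutativeRing ℝ-ring using (+-comm; +-group; +-commutativeSemigroup)
  open GroupProperties +-group using (∙-cancelʳ)
  open CommSemigroupProperties +-commutativeSemigroup public using (xy∙z≈xz∙y)

  +-cancelʳ : ∀ {a b} k → a + k ≡ b + k → a ≡ b
  +-cancelʳ {a} {b} k = ∙-cancelʳ k a b

  +-cancelˡ : ∀ {a b} k → k + a ≡ k + b → a ≡ b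
  +-cancelˡ {a} {b} k e = +-cancelʳ k (trans (+-comm a k) (trans e (+-comm k b)))

  ≤-cancelʳ : ∀ {a b} k → a + k ≤ b + k → a ≤ b
  ≤-cancelʳ {a} {b} k h = subst₂ _≤_ (undo a) (undo b) (+-mono-≤ (- k) h)
    where
    open CommutativeRing ℝ-ring using (+-assoc; -‿inverseʳ; +-identityʳ)
    undo : ∀ x → (x + k) + - k ≡ x
    undo x = trans (+-assoc x k (- k)) (trans (cong (x +_) (-‿inverseʳ k)) (+-identityʳ x))

  ≤-cycle : ∀ {a b c} → a ≤ b → b ≤ c → c ≤ a → a ≡ b × a ≡ c
  ≤-cycle a≤b b≤c c≤a =
    ≤-antisym a≤b (≤-trans b≤c c≤a) , ≤-antisym (≤-trans a≤b b≤c) c≤a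

  state-below⇒ : ∀ {p q} → p ≼ q → s q + s (q ⇒ p) ≡ s p + 1ℝ
  state-below⇒ {p} {q} p≼q = begin
      s q + s (q ⇒ p)  ≡⟨ sym (bos⇒ p q) ⟩
      s p + s (p ⇒ q)  ≡⟨ cong (λ t → s p + s t) p≼q ⟩
      s p + s 𝟏        ≡⟨ cong (s p +_) s-one ⟩
      s p + 1ℝ         ∎
    where open ≡-Reasoning

  state-below⇝ : ∀ {p q} → p ≼ q → s q + s (q ⇝ p) ≡ s p + 1ℝ
  state-below⇝ {p} {q} p≼q = begin
      s q + s (q ⇝ p)  ≡⟨ sym (bos⇝ p q) ⟩
      s p + s (p ⇝ q)  ≡⟨ cong (λ t → s p + s t) (⇒to⇝ p q p≼q) ⟩
      s p + s 𝟏        ≡⟨ cong (s p +_) s-one ⟩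
      s p + 1ℝ         ∎
    where open ≡-Reasoning

  residuals-agree : ∀ {p q} → p ≼ q → s (q ⇒ p) ≡ s (q ⇝ p)
  residuals-agree p≼q = +-cancelˡ _ (trans (state-below⇒ p≼q) (sym (state-below⇝ p≼q)))

  state-mono : ∀ {p q} → p ≼ q → s p ≤ s q
  state-mono {p} {q} p≼q = ≤-cancelʳ 1ℝ
    (subst₂ _≤_ (state-below⇒ p≼q) (+-comm 1ℝ (s q))
      (subst (_≤ 1ℝ + s q) (+-comm (s (q ⇒ p)) (s q)) (+-mono-≤ (s q) (s-high (q ⇒ p)))))

  ker-upward : ∀ {p q} → p ≼ q → s p ≡ 1ℝ → s q ≡ 1ℝ
  ker-upward {p} {q} p≼q sp≡1 =
    ≤-antisym (s-high q) (subst (_≤ s q) sp≡1 (state-mono p≼q))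

  ker-swap : ∀ {p q} → s p ≡ s q → s (p ⇒ q) ≡ 1ℝ → s (q ⇒ p) ≡ 1ℝ
  ker-swap {p} {q} sp≡sq pq∈K = +-cancelˡ (s q) (begin
      s q + s (q ⇒ p)  ≡⟨ sym (bos⇒ p q) ⟩
      s p + s (p ⇒ q)  ≡⟨ cong₂ _+_ sp≡sq pq∈K ⟩
      s q + 1ℝ         ∎)
    where open ≡-Reasoning

  ≼-in-ker : ∀ {p q} → p ≼ q → s (p ⇒ q) ≡ 1ℝ
  ≼-in-ker p≼q = trans (cong s p≼q) s-one

  equal-state⇝-in-ker : ∀ {p q} → p ≼ q → s p ≡ s q → s (q ⇝ p) ≡ 1ℝ
  equal-state⇝-in-ker {p} {q} p≼q sp≡sq =
    +-cancelˡ (s q) (trans (state-below⇝ p≼q) (cong (_+ 1ℝ) sp≡sq))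

  equal-state-Θ : ∀ {p q} → p ≼ q → s p ≡ s q → Θ B (Ker st) q p
  equal-state-Θ p≼q sp≡sq =
    trans (residuals-agree p≼q) (equal-state⇝-in-ker p≼q sp≡sq) , ≼-in-ker p≼q

module JoinsModuloKernel (R : RealNumbers) (B : PseudoBE) (bea : IsPseudoBEA B)
                         (dist : IsDistributive B) (st : BosbachState R B) where
  open RealNumbers R
  open PseudoBE B
  open BosbachState st
  open PseudoBEOrder B
  open DistributiveOrder B dist
  open BosbachFacts R B st

  -- With c = (x ⇒ y) ⇝ y:  s (x ⇒ y) ≤ s (c ⇒ y) = s (c ⇝ y) ≤ s (x ⇝ y) ≤ s (x ⇒ y),
  -- so the two residuals have equal state, which also equals s (c ⇒ y).
  residual-cycle : ∀ x y →
    s (x ⇒ y) ≡ s (((x ⇒ y) ⇝ y) ⇒ y) × s (x ⇒ y) ≡ s (x ⇝ y)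
  residual-cycle x y = ≤-cycle a≤c⇒y c⇒y≤b (state-mono (⇝-≼-⇒ x y))
    where
    c = (x ⇒ y) ⇝ y
    a≤c⇒y : s (x ⇒ y) ≤ s (c ⇒ y)
    a≤c⇒y = state-mono (≼-join⇒ (x ⇒ y) y)
    c⇒y≤b : s (c ⇒ y) ≤ s (x ⇝ y)
    c⇒y≤b = subst (_≤ s (x ⇝ y)) (sym (residuals-agree (≼-⇝ (x ⇒ y) y)))
              (state-mono (proj₂ (bea x c y (≼-join⇝ x y))))

  join⇝-state : ∀ x y → s ((x ⇒ y) ⇝ y) + s (x ⇒ y) ≡ s y + 1ℝ
  join⇝-state x y = trans (cong (s ((x ⇒ y) ⇝ y) +_) (proj₁ (residual-cycle x y)))
                          (state-below⇒ (≼-⇝ (x ⇒ y) y))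

  join⇝-state′ : ∀ x y → s ((x ⇒ y) ⇝ y) + s (y ⇒ x) ≡ s x + 1ℝ
  join⇝-state′ x y = +-cancelʳ (s (x ⇒ y)) (begin
      (s u′ + s (y ⇒ x)) + s (x ⇒ y)  ≡⟨ xy∙z≈xz∙y (s u′) _ _ ⟩
      (s u′ + s (x ⇒ y)) + s (y ⇒ x)  ≡⟨ cong (_+ s (y ⇒ x)) (join⇝-state x y) ⟩
      (s y + 1ℝ) + s (y ⇒ x)          ≡⟨ xy∙z≈xz∙y (s y) _ _ ⟩
      (s y + s (y ⇒ x)) + 1ℝ          ≡⟨ cong (_+ 1ℝ) (sym (bos⇒ x y)) ⟩
      (s x + s (x ⇒ y)) + 1ℝ          ≡⟨ xy∙z≈xz∙y (s x) _ _ ⟩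
      (s x + 1ℝ) + s (x ⇒ y)          ∎)
    where
    open ≡-Reasoning
    u′ = (x ⇒ y) ⇝ y

  join⇝-symmetric : ∀ x y → s ((x ⇒ y) ⇝ y) ≡ s ((y ⇒ x) ⇝ x)
  join⇝-symmetric x y = +-cancelʳ (s (y ⇒ x)) (trans (join⇝-state′ x y) (sym (join⇝-state y x)))

  -- u′ ⇒ v′ = (y ⇒ x) ⇝ (u′ ⇒ x), where u′ ⇒ x ≼ y ⇒ x (as y ≼ u′) and both
  -- have the same state (compare state-below⇒ for x ≼ u′ with join⇝-state′).
  join⇝-comparable : ∀ x y → s (((x ⇒ y) ⇝ y) ⇒ ((y ⇒ x) ⇝ x)) ≡ 1ℝ
  join⇝-comparable x y = trans (cong s (exch u′ (y ⇒ x) x))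
                               (equal-state⇝-in-ker w≼y⇒x sw≡sy⇒x)
    where
    u′ = (x ⇒ y) ⇝ y
    w≼y⇒x : u′ ⇒ x ≼ y ⇒ x
    w≼y⇒x = proj₁ (bea y u′ x (≼-⇝ (x ⇒ y) y))
    sw≡sy⇒x : s (u′ ⇒ x) ≡ s (y ⇒ x)
    sw≡sy⇒x = +-cancelˡ (s u′) (trans (state-below⇒ (≼-join⇝ x y)) (sym (join⇝-state′ x y)))

  -- Pass from the ⇝-joins u′, v′ to the ⇒-joins u, v: v′ ⇒ u ∈ K lies above
  -- v′ ⇒ u′ ∈ K, swap using s u = s u′ = s v′, then climb from u ⇒ v′ to u ⇒ v.
  join⇒-comparable : ∀ x y → s (((x ⇒ y) ⇒ y) ⇒ ((y ⇒ x) ⇒ x)) ≡ 1ℝ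
  join⇒-comparable x y = ker-upward (⇒-isotone u (⇝-≼-⇒ (y ⇒ x) x)) u⇒v′∈K
    where
    u  = (x ⇒ y) ⇒ y
    v′ = (y ⇒ x) ⇝ x
    v′⇒u∈K : s (v′ ⇒ u) ≡ 1ℝ
    v′⇒u∈K = ker-upward (⇒-isotone v′ (⇝-≼-⇒ (x ⇒ y) y)) (join⇝-comparable y x)
    sv′≡su : s v′ ≡ s u
    sv′≡su = sym (trans (proj₂ (residual-cycle (x ⇒ y) y)) (join⇝-symmetric x y))
    u⇒v′∈K : s (u ⇒ v′) ≡ 1ℝ
    u⇒v′∈K = ker-swap sv′≡su v′⇒u∈K

theorem3p6 : (R : RealNumbers) (B : PseudoBE) → IsPseudoBEA B → IsDistributive B →
    (st : BosbachState R B) →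
    let open PseudoBE B in
    (∀ x y → Θ B (Ker st) (x ⇒ y) (x ⇝ y)) ×
    (∀ x y → Θ B (Ker st) ((x ⇒ y) ⇒ y) ((y ⇒ x) ⇒ x))
theorem3p6 R B bea dist st = residuals-congruent , joins-congruent
  where
  open PseudoBE B
  open DistributiveOrder B dist using (⇝-≼-⇒)
  open BosbachFacts R B st using (equal-state-Θ)
  open JoinsModuloKernel R B bea dist st

  residuals-congruent : ∀ x y → Θ B (Ker st) (x ⇒ y) (x ⇝ y)
  residuals-congruent x y = equal-state-Θ (⇝-≼-⇒ x y) (sym (proj₂ (residual-cycle x y)))

  joins-congruent : ∀ x y → Θ B (Ker st) ((x ⇒ y) ⇒ y) ((y ⇒ x) ⇒ x)
  joins-congruent x y = join⇒-comparable x y , join⇒-comparable y x
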